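{- Let $k$ be a positive integer. If there exist an even integer $u\ge2$ and a positive integer $s<u-1$ such that $L_{u+2}(k)=0\,0\,1^u$ and $U_{u+s+1}(k)=1^u\,0^s\,1$, then $f(k)<k$.
   Context: $s_2(n)$ is the binary sum of digits of $n\ge0$, $t_n=s_2(n)\bmod 2$, and $f(k)=\min\{n\ge0: t_{kn}=1\}$ for $k\ge1$. If $k=\sum_{i=0}^{\ell-1}\varepsilon_i 2^i$ with $\varepsilon_i\in\{0,1\}$, $\varepsilon_{\ell-1}=1$, then $\ell=\ell(k)$ is the binary length; for $1\le j\le \ell(k)$, $L_j(k)=\varepsilon_{j-1}\cdots\varepsilon_0$ is the word of the $j$ least significant binary digits and $U_j(k)=\varepsilon_{\ell-1}\cdots\varepsilon_{\ell-j}$ is the word of the $j$ most significant binary digits (use of $L_j(k)$ or $U_j(k)$ presupposes $\ell(k)\ge j$). For $a\in\{0,1\}$, $a^n$ denotes the word consisting of $n$ copies of $a$; juxtaposition denotes concatenation. -}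

module Defs where

open import Data.Nat using (ℕ; zero; suc; _+_; _*_; _<_; _≤_)
open import Data.Nat.DivMod using (_/_; _%_)
open import Data.Bool using (Bool; true; false)
open import Data.List using (List; []; _∷_; reverse)
open import Data.Product using (_×_)
open import Relation.Binary.PropositionalEquality using (_≡_)
open import Data.List using (take; length)

-- binary digits of n, least significant first, with fuel (fuel ≥ n suffices)
bitsF : ℕ → ℕ → List Bool
bitsF zero    _ = []
bitsF (suc f) zero = []
bitsF (suc f) (suc m) with (suc m) % 2
... | zero = false ∷ bitsF f (suc m / 2)
... | suc _ = true ∷ bitsF f (suc m / 2)

-- bits n = ε₀ ε₁ … ε_{ℓ-1} (no leading zeros; bits 0 = [])
bits : ℕ → List Bool
bits n = bitsF n n

s₂F : ℕ → ℕ → ℕ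
s₂F zero _ = zero
s₂F (suc f) n = n % 2 + s₂F f (n / 2)

s₂ : ℕ → ℕ
s₂ n = s₂F n n

t : ℕ → ℕ
t n = s₂ n % 2

IsF : ℕ → ℕ → Set
IsF k m = (t (k * m) ≡ 1) × ((n : ℕ) → n < m → t (k * n) ≡ 0)

ℓ : ℕ → ℕ
ℓ k = length (bits k)

-- L j k = ε_{j-1} ⋯ ε₀ as a word (written most significant first)
L : ℕ → ℕ → List Bool
L j k = reverse (take j (bits k))

-- U j k = ε_{ℓ-1} ⋯ ε_{ℓ-j} as a word (written most significant first)
U : ℕ → ℕ → List Bool
U j k = take j (reverse (bits k))

{-# OPTIONS --safe #-}
-- The top digits give k = R + 2^(a+1)·(2^u − 1) with R < 2^a, and the bottom digits give
-- k ≡ 2^u − 1 (mod 2^u), which forces a ≥ u and R ≡ 2^u − 1 (mod 2^u).  For b = a and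
-- b = a + 1, writing k(2^b − 1) = k·2^b − k lays the product out in base 2^b without carries
-- as (2^b − R) + 2^b((R − 1 − q) + 2^b q), q the block above R, and s₂(2^b − R) = b − s₂(R − 1).
-- The two digit sums then differ by u + 1, which is odd, so t(k(2^a − 1)) or t(k(2^(a+1) − 1))
-- is 1, and both multipliers are below k.  When R = 2^u − 1 the layout for b = a needs one
-- borrow, and t(k(2^a − 1)) = 1 outright.
module Submission where

open import Defs
open import Data.Nat using (ℕ; _+_; _*_; _<_; _≤_; _∸_)
open import Data.Nat.Divisibility using (_∣_)
open import Data.Bool using (Bool; true; false)
open import Data.List using (List; _∷_; []; _++_; replicate)
open import Data.Product using (Σ; _×_)
open import Relation.Binary.PropositionalEquality using (_≡_)

open import Data.Nat using (zero; suc; _^_; _/_; _%_; NonZero; z≤n; s≤s; s≤s⁻¹; _≤?_; _≟_)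
open import Data.Nat.Properties
open import Data.Nat.DivMod
open import Data.Nat.Divisibility using (divides; ∣m⇒∣m*n; m∣m*n)
open import Data.Nat.Tactic.RingSolver using (solve-∀)
open import Data.List using (length; reverse; take; drop)
open import Data.List.Properties using (length-replicate; reverse-++; reverse-involutive; take++drop≡id; ++-assoc)
open import Data.Product using (_,_)
open import Data.Sum using (_⊎_; inj₁; inj₂; [_,_]′)
open import Relation.Nullary using (¬_; yes; no; contradiction)
open import Relation.Unary using (Decidable)
open import Relation.Binary.PropositionalEquality using (_≢_; refl; sym; trans; cong; cong₂; subst; module ≡-Reasoning)
open ≡-Reasoning

^-monoʳ-∣ : ∀ m {i j} → i ≤ j → m ^ i ∣ m ^ j
^-monoʳ-∣ m {i} {j} i≤j = subst (m ^ i ∣_) m^i*m^[j∸i]≡m^j (m∣m*n (m ^ (j ∸ i)))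
  where
  m^i*m^[j∸i]≡m^j : m ^ i * m ^ (j ∸ i) ≡ m ^ j
  m^i*m^[j∸i]≡m^j = trans (sym (^-distribˡ-+-* m i (j ∸ i))) (cong (m ^_) (m+[n∸m]≡n i≤j))

n≤1+f⇒n/2≤f : ∀ n f → n ≤ suc f → n / 2 ≤ f
n≤1+f⇒n/2≤f zero    f _         = z≤n
n≤1+f⇒n/2≤f (suc n) f (s≤s n≤f) = ≤-trans (<⇒≤pred (m/n<m (suc n) 2 (s≤s (s≤s z≤n)))) n≤f

s₂F-fuel-irrelevant : ∀ f g n → n ≤ f → n ≤ g → s₂F f n ≡ s₂F g n
s₂F-fuel-irrelevant zero    zero    n       _   _   = refl
s₂F-fuel-irrelevant zero    (suc g) zero    _   _   = s₂F-fuel-irrelevant zero g zero z≤n z≤n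
s₂F-fuel-irrelevant (suc f) zero    zero    _   _   = s₂F-fuel-irrelevant f zero zero z≤n z≤n
s₂F-fuel-irrelevant (suc f) (suc g) n       n≤f n≤g =
  cong (n % 2 +_) (s₂F-fuel-irrelevant f g (n / 2) (n≤1+f⇒n/2≤f n f n≤f) (n≤1+f⇒n/2≤f n g n≤g))

s₂-unfold : ∀ n → s₂ n ≡ n % 2 + s₂ (n / 2)
s₂-unfold zero    = refl
s₂-unfold (suc n) = cong (suc n % 2 +_)
  (s₂F-fuel-irrelevant n (suc n / 2) (suc n / 2) (n≤1+f⇒n/2≤f (suc n) n ≤-refl) ≤-refl)

n%2≡b⇒n≡b+2[n/2] : ∀ n b → n % 2 ≡ b → n ≡ b + 2 * (n / 2)
n%2≡b⇒n≡b+2[n/2] n b n%2≡b = trans (m≡m%n+[m/n]*n n 2) (cong₂ _+_ n%2≡b (*-comm (n / 2) 2))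

[b+2n]%2≡b : ∀ b n → b < 2 → (b + 2 * n) % 2 ≡ b
[b+2n]%2≡b b n b<2 = begin
  (b + 2 * n) % 2 ≡⟨ cong (λ m → (b + m) % 2) (*-comm 2 n) ⟩
  (b + n * 2) % 2 ≡⟨ [m+kn]%n≡m%n b n 2 ⟩
  b % 2           ≡⟨ m<n⇒m%n≡m b<2 ⟩
  b               ∎

[b+2n]/2≡n : ∀ b n → b < 2 → (b + 2 * n) / 2 ≡ n
[b+2n]/2≡n b n b<2 = begin
  (b + 2 * n) / 2     ≡⟨ cong (λ m → (b + m) / 2) (*-comm 2 n) ⟩
  (b + n * 2) / 2     ≡⟨ +-distrib-/ b (n * 2) digits<2 ⟩
  b / 2 + n * 2 / 2   ≡⟨ cong₂ _+_ (m<n⇒m/n≡0 b<2) (m*n/n≡m n 2) ⟩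
  n                   ∎
  where
  digits<2 : b % 2 + n * 2 % 2 < 2
  digits<2 = subst (_< 2) (cong₂ _+_ (sym (m<n⇒m%n≡m b<2)) (sym (m*n%n≡0 n 2))) (subst (_< 2) (sym (+-identityʳ b)) b<2)

s₂-digit : ∀ b n → b < 2 → s₂ (b + 2 * n) ≡ b + s₂ n
s₂-digit b n b<2 = begin
  s₂ (b + 2 * n)                               ≡⟨ s₂-unfold (b + 2 * n) ⟩
  (b + 2 * n) % 2 + s₂ ((b + 2 * n) / 2)       ≡⟨ cong₂ (λ r q → r + s₂ q) ([b+2n]%2≡b b n b<2) ([b+2n]/2≡n b n b<2) ⟩
  b + s₂ n                                     ∎

s₂-double : ∀ n → s₂ (2 * n) ≡ s₂ n
s₂-double n = s₂-digit 0 n (s≤s z≤n)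

s₂-double+1 : ∀ n → s₂ (suc (2 * n)) ≡ suc (s₂ n)
s₂-double+1 n = s₂-digit 1 n (s≤s (s≤s z≤n))

s₂-concat : ∀ j x y → y < 2 ^ j → s₂ (y + 2 ^ j * x) ≡ s₂ y + s₂ x
s₂-concat zero    x zero    _         = cong s₂ (+-identityʳ x)
s₂-concat zero    x (suc y) (s≤s ())
s₂-concat (suc j) x y       y<2^[1+j] = begin
  s₂ (y + 2 ^ suc j * x)                    ≡⟨ cong s₂ regroup ⟩
  s₂ (y % 2 + 2 * (y / 2 + 2 ^ j * x))      ≡⟨ s₂-digit (y % 2) (y / 2 + 2 ^ j * x) (m%n<n y 2) ⟩
  y % 2 + s₂ (y / 2 + 2 ^ j * x)            ≡⟨ cong (y % 2 +_) (s₂-concat j x (y / 2) y/2<2^j) ⟩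
  y % 2 + (s₂ (y / 2) + s₂ x)               ≡⟨ sym (+-assoc (y % 2) _ _) ⟩
  y % 2 + s₂ (y / 2) + s₂ x                 ≡⟨ cong (_+ s₂ x) (sym (s₂-unfold y)) ⟩
  s₂ y + s₂ x                               ∎
  where
  regroup : y + 2 ^ suc j * x ≡ y % 2 + 2 * (y / 2 + 2 ^ j * x)
  regroup = trans (cong (_+ 2 ^ suc j * x) (n%2≡b⇒n≡b+2[n/2] y (y % 2) refl)) (ring (y % 2) (y / 2) (2 ^ j) x)
    where
    ring : ∀ r q P x → r + 2 * q + 2 * P * x ≡ r + 2 * (q + P * x)
    ring = solve-∀
  y/2<2^j : y / 2 < 2 ^ j
  y/2<2^j = m<n*o⇒m/o<n (subst (y <_) (*-comm 2 (2 ^ j)) y<2^[1+j])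

data EvenOrOdd : ℕ → Set where
  even : ∀ m → EvenOrOdd (2 * m)
  odd  : ∀ m → EvenOrOdd (suc (2 * m))

evenOrOdd : ∀ n → EvenOrOdd n
evenOrOdd zero = even 0
evenOrOdd (suc n) with evenOrOdd n
... | even m = odd m
... | odd m  = subst EvenOrOdd (*-suc 2 m) (even (suc m))

s₂-complement : ∀ a c p → c + suc p ≡ 2 ^ a → s₂ c + s₂ p ≡ a
s₂-complement zero    zero    zero    _ = refl
s₂-complement zero    zero    (suc p) ()
s₂-complement zero    (suc c) p       e = contradiction (suc-injective e) (m+1+n≢0 c)
s₂-complement (suc a) c       p       e with evenOrOdd c | evenOrOdd p
... | even x | even y = contradiction (trans (sym e) (ring x y)) (even≢odd (2 ^ a) (x + y))
  where
  ring : ∀ x y → 2 * x + suc (2 * y) ≡ suc (2 * (x + y))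
  ring = solve-∀
... | odd x  | odd y  = contradiction (trans (sym e) (ring x y)) (even≢odd (2 ^ a) (suc (x + y)))
  where
  ring : ∀ x y → suc (2 * x) + suc (suc (2 * y)) ≡ suc (2 * suc (x + y))
  ring = solve-∀
... | even x | odd y  = begin
  s₂ (2 * x) + s₂ (suc (2 * y)) ≡⟨ cong₂ _+_ (s₂-double x) (s₂-double+1 y) ⟩
  s₂ x + suc (s₂ y)             ≡⟨ +-suc (s₂ x) (s₂ y) ⟩
  suc (s₂ x + s₂ y)             ≡⟨ cong suc (s₂-complement a x y (*-cancelˡ-≡ _ _ 2 (trans (sym (ring x y)) e))) ⟩
  suc a                         ∎
  where
  ring : ∀ x y → 2 * x + suc (suc (2 * y)) ≡ 2 * (x + suc y)
  ring = solve-∀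
... | odd x  | even y = begin
  s₂ (suc (2 * x)) + s₂ (2 * y) ≡⟨ cong₂ _+_ (s₂-double+1 x) (s₂-double y) ⟩
  suc (s₂ x + s₂ y)             ≡⟨ cong suc (s₂-complement a x y (*-cancelˡ-≡ _ _ 2 (trans (sym (ring x y)) e))) ⟩
  suc a                         ∎
  where
  ring : ∀ x y → suc (2 * x) + suc (2 * y) ≡ 2 * (x + suc y)
  ring = solve-∀

M : ℕ → ℕ
M zero    = 0
M (suc j) = suc (2 * M j)

suc[M]≡2^ : ∀ j → suc (M j) ≡ 2 ^ j
suc[M]≡2^ zero    = refl
suc[M]≡2^ (suc j) = trans (sym (*-suc 2 (M j))) (cong (2 *_) (suc[M]≡2^ j))

M<2^ : ∀ j → M j < 2 ^ j
M<2^ j = ≤-reflexive (suc[M]≡2^ j)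

2^≤M[1+] : ∀ j → 2 ^ j ≤ M (suc j)
2^≤M[1+] j = subst (_≤ M (suc j)) (suc[M]≡2^ j) (s≤s (m≤m+n (M j) (M j + 0)))

M≤M[1+] : ∀ j → M j ≤ M (suc j)
M≤M[1+] j = m≤n⇒m≤1+n (m≤m+n (M j) (M j + 0))

s₂-M : ∀ j → s₂ (M j) ≡ j
s₂-M zero    = refl
s₂-M (suc j) = trans (s₂-double+1 (M j)) (cong suc (s₂-M j))

M-+ : ∀ i j → M (i + j) ≡ M i + 2 ^ i * M j
M-+ zero    j = sym (+-identityʳ (M j))
M-+ (suc i) j = trans (cong (λ m → suc (2 * m)) (M-+ i j)) (ring (M i) (2 ^ i) (M j))
  where
  ring : ∀ a P b → suc (2 * (a + P * b)) ≡ suc (2 * a) + 2 * P * b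
  ring = solve-∀

module _ {j : ℕ} where
  private instance
    2^j≢0 : NonZero (2 ^ j)
    2^j≢0 = m^n≢0 2 j

  [M+2^*]%2^ : ∀ u K → j ≤ u → (M u + 2 ^ u * K) % 2 ^ j ≡ M j
  [M+2^*]%2^ u K j≤u = begin
    (M u + 2 ^ u * K) % 2 ^ j                         ≡⟨ %-remove-+ʳ (M u) (∣m⇒∣m*n K (^-monoʳ-∣ 2 j≤u)) ⟩
    M u % 2 ^ j                                       ≡⟨ cong (_% 2 ^ j) (trans (cong M (sym (m+[n∸m]≡n j≤u))) (M-+ j (u ∸ j))) ⟩
    (M j + 2 ^ j * M (u ∸ j)) % 2 ^ j                 ≡⟨ %-remove-+ʳ (M j) (m∣m*n (M (u ∸ j))) ⟩
    M j % 2 ^ j                                       ≡⟨ m<n⇒m%n≡m (M<2^ j) ⟩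
    M j                                               ∎

  R%2^j≡Mj : ∀ u K a R k → k ≡ M u + 2 ^ u * K → k ≡ R + 2 ^ suc a * M u → j ≤ u → j ≤ suc a → R % 2 ^ j ≡ M j
  R%2^j≡Mj u K a R k k≡M k≡R j≤u j≤1+a = begin
    R % 2 ^ j                     ≡⟨ sym (%-remove-+ʳ R (∣m⇒∣m*n (M u) (^-monoʳ-∣ 2 j≤1+a))) ⟩
    (R + 2 ^ suc a * M u) % 2 ^ j ≡⟨ cong (_% 2 ^ j) (trans (sym k≡R) k≡M) ⟩
    (M u + 2 ^ u * K) % 2 ^ j     ≡⟨ [M+2^*]%2^ u K j≤u ⟩
    M j                           ∎

fromBits : List Bool → ℕ
fromBits []           = 0
fromBits (false ∷ bs) = 2 * fromBits bs
fromBits (true ∷ bs)  = suc (2 * fromBits bs)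

fromBits-bitsF : ∀ f n → n ≤ f → fromBits (bitsF f n) ≡ n
fromBits-bitsF zero    zero    _   = refl
fromBits-bitsF (suc f) zero    _   = refl
fromBits-bitsF (suc f) (suc n) n≤f with suc n % 2 in digit
... | zero        = trans (cong (2 *_) (fromBits-bitsF f (suc n / 2) (n≤1+f⇒n/2≤f (suc n) f n≤f)))
                          (sym (n%2≡b⇒n≡b+2[n/2] (suc n) 0 digit))
... | suc zero    = cong suc (trans (cong (2 *_) (fromBits-bitsF f (suc n / 2) (n≤1+f⇒n/2≤f (suc n) f n≤f)))
                                    (suc-injective (sym (n%2≡b⇒n≡b+2[n/2] (suc n) 1 digit))))
... | suc (suc _) = contradiction (subst (_< 2) digit (m%n<n (suc n) 2)) λ { (s≤s (s≤s ())) }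

fromBits-bits : ∀ n → fromBits (bits n) ≡ n
fromBits-bits n = fromBits-bitsF n n ≤-refl

2*[a+P*b]≡2*a+2*P*b : ∀ a P b → 2 * (a + P * b) ≡ 2 * a + 2 * P * b
2*[a+P*b]≡2*a+2*P*b = solve-∀

fromBits-++ : ∀ xs ys → fromBits (xs ++ ys) ≡ fromBits xs + 2 ^ length xs * fromBits ys
fromBits-++ []           ys = sym (+-identityʳ (fromBits ys))
fromBits-++ (false ∷ xs) ys =
  trans (cong (2 *_) (fromBits-++ xs ys)) (2*[a+P*b]≡2*a+2*P*b (fromBits xs) (2 ^ length xs) (fromBits ys))
fromBits-++ (true ∷ xs)  ys =
  cong suc (trans (cong (2 *_) (fromBits-++ xs ys)) (2*[a+P*b]≡2*a+2*P*b (fromBits xs) (2 ^ length xs) (fromBits ys)))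

m<n⇒1+2m<2n : ∀ {m n} → m < n → suc (2 * m) < 2 * n
m<n⇒1+2m<2n {m} {n} m<n = subst (_≤ 2 * n) (*-suc 2 m) (*-monoʳ-≤ 2 m<n)

fromBits-< : ∀ xs → fromBits xs < 2 ^ length xs
fromBits-< []           = s≤s z≤n
fromBits-< (false ∷ xs) = <-trans (n<1+n _) (m<n⇒1+2m<2n (fromBits-< xs))
fromBits-< (true ∷ xs)  = m<n⇒1+2m<2n (fromBits-< xs)

fromBits-ones : ∀ j → fromBits (replicate j true) ≡ M j
fromBits-ones zero    = refl
fromBits-ones (suc j) = cong (λ m → suc (2 * m)) (fromBits-ones j)

fromBits-zeros-++ : ∀ s xs → fromBits (replicate s false ++ xs) ≡ 2 ^ s * fromBits xs
fromBits-zeros-++ zero    xs = sym (*-identityˡ (fromBits xs))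
fromBits-zeros-++ (suc s) xs = trans (cong (2 *_) (fromBits-zeros-++ s xs)) (sym (*-assoc 2 (2 ^ s) (fromBits xs)))

reverse-replicate : ∀ {A : Set} n (x : A) → reverse (replicate n x) ≡ replicate n x
reverse-replicate zero    x = refl
reverse-replicate (suc n) x = begin
  reverse (x ∷ replicate n x)   ≡⟨ reverse-++ (x ∷ []) (replicate n x) ⟩
  reverse (replicate n x) ++ x ∷ [] ≡⟨ cong (_++ x ∷ []) (reverse-replicate n x) ⟩
  replicate n x ++ x ∷ []       ≡⟨ snoc n ⟩
  x ∷ replicate n x             ∎
  where
  snoc : ∀ n → replicate n x ++ x ∷ [] ≡ x ∷ replicate n x
  snoc zero    = refl
  snoc (suc n) = cong (x ∷_) (snoc n)

L-ones-form : ∀ j k u w → L j k ≡ w ++ replicate u true → Σ ℕ λ K → k ≡ M u + 2 ^ u * K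
L-ones-form j k u w L≡ = fromBits rest , (begin
  k                                                 ≡⟨ sym (fromBits-bits k) ⟩
  fromBits (bits k)                                 ≡⟨ cong fromBits bits≡ ⟩
  fromBits (ones ++ rest)                           ≡⟨ fromBits-++ ones rest ⟩
  fromBits ones + 2 ^ length ones * fromBits rest   ≡⟨ cong₂ (λ m n → m + 2 ^ n * fromBits rest) (fromBits-ones u) (length-replicate u) ⟩
  M u + 2 ^ u * fromBits rest                       ∎)
  where
  ones = replicate u true
  high = drop j (bits k)
  rest = reverse w ++ high
  bits≡ : bits k ≡ ones ++ rest
  bits≡ = begin
    bits k                            ≡⟨ sym (take++drop≡id j (bits k)) ⟩
    take j (bits k) ++ high           ≡⟨ cong (_++ high) (sym (reverse-involutive (take j (bits k)))) ⟩
    reverse (L j k) ++ high           ≡⟨ cong (λ v → reverse v ++ high) L≡ ⟩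
    reverse (w ++ ones) ++ high       ≡⟨ cong (_++ high) (reverse-++ w ones) ⟩
    (reverse ones ++ reverse w) ++ high ≡⟨ cong (λ v → (v ++ reverse w) ++ high) (reverse-replicate u true) ⟩
    (ones ++ reverse w) ++ high       ≡⟨ ++-assoc ones (reverse w) high ⟩
    ones ++ rest                      ∎

U-form : ∀ j k u s → 1 ≤ s → U j k ≡ replicate u true ++ replicate s false ++ true ∷ [] →
         Σ ℕ λ a → Σ ℕ λ R → R < 2 ^ a × k ≡ R + 2 ^ suc a * M u
U-form j k u s 1≤s U≡ = c + s , fromBits low + 2 ^ c , R< , (begin
  k                                                   ≡⟨ sym (fromBits-bits k) ⟩
  fromBits (bits k)                                   ≡⟨ cong fromBits bits≡ ⟩
  fromBits (low ++ reverse top)                       ≡⟨ fromBits-++ low (reverse top) ⟩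
  fromBits low + 2 ^ c * fromBits (reverse top)       ≡⟨ cong (λ v → fromBits low + 2 ^ c * fromBits v) reverse-top ⟩
  fromBits low + 2 ^ c * suc (2 * fromBits (zeros ++ ones))
    ≡⟨ cong (λ v → fromBits low + 2 ^ c * suc (2 * v)) (trans (fromBits-zeros-++ s ones) (cong (2 ^ s *_) (fromBits-ones u))) ⟩
  fromBits low + 2 ^ c * suc (2 * (2 ^ s * M u))      ≡⟨ ring (fromBits low) (2 ^ c) (2 ^ s) (M u) ⟩
  fromBits low + 2 ^ c + 2 * (2 ^ c * 2 ^ s) * M u    ≡⟨ cong (λ P → fromBits low + 2 ^ c + 2 * P * M u) (sym (^-distribˡ-+-* 2 c s)) ⟩
  fromBits low + 2 ^ c + 2 ^ suc (c + s) * M u        ∎)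
  where
  ones  = replicate u true
  zeros = replicate s false
  top   = ones ++ zeros ++ true ∷ []
  low   = reverse (drop j (reverse (bits k)))
  c     = length low
  bits≡ : bits k ≡ low ++ reverse top
  bits≡ = begin
    bits k                                    ≡⟨ sym (reverse-involutive (bits k)) ⟩
    reverse (reverse (bits k))                ≡⟨ cong reverse (sym (take++drop≡id j (reverse (bits k)))) ⟩
    reverse (U j k ++ drop j (reverse (bits k))) ≡⟨ reverse-++ (U j k) _ ⟩
    low ++ reverse (U j k)                    ≡⟨ cong (λ v → low ++ reverse v) U≡ ⟩
    low ++ reverse top                        ∎
  reverse-top : reverse top ≡ true ∷ zeros ++ ones
  reverse-top = begin
    reverse (ones ++ zeros ++ true ∷ [])            ≡⟨ reverse-++ ones (zeros ++ true ∷ []) ⟩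
    reverse (zeros ++ true ∷ []) ++ reverse ones    ≡⟨ cong (_++ reverse ones) (reverse-++ zeros (true ∷ [])) ⟩
    (true ∷ reverse zeros) ++ reverse ones
      ≡⟨ cong₂ (λ v w → (true ∷ v) ++ w) (reverse-replicate s false) (reverse-replicate u true) ⟩
    true ∷ zeros ++ ones                            ∎
  ring : ∀ v P S m → v + P * suc (2 * (S * m)) ≡ v + P + 2 * (P * S) * m
  ring = solve-∀
  R< : fromBits low + 2 ^ c < 2 ^ (c + s)
  R< = <-≤-trans (+-monoˡ-< (2 ^ c) (fromBits-< low)) (subst (_≤ 2 ^ (c + s)) 2^[c+1]≡ (^-monoʳ-≤ 2 (+-monoʳ-≤ c 1≤s)))
    where
    2^[c+1]≡ : 2 ^ (c + 1) ≡ 2 ^ c + 2 ^ c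
    2^[c+1]≡ = trans (cong (2 ^_) (+-comm c 1)) (cong (2 ^ c +_) (+-identityʳ (2 ^ c)))

c+1+n≡P⇒c<P : ∀ {c n P} → c + suc n ≡ P → c < P
c+1+n≡P⇒c<P {c} {n} refl = m<m+n c (s≤s z≤n)

*-M-digits : ∀ b m q c k → k ≡ suc (m + q) + 2 ^ b * q → c + suc (m + q) ≡ 2 ^ b →
             k * M b ≡ c + 2 ^ b * (m + 2 ^ b * q)
*-M-digits b m q c .(suc (m + q) + 2 ^ b * q) refl c+r≡P = +-cancelʳ-≡ k _ _ (begin
  k * M b + k                           ≡⟨ trans (+-comm (k * M b) k) (sym (*-suc k (M b))) ⟩
  k * suc (M b)                         ≡⟨ cong (k *_) (suc[M]≡2^ b) ⟩
  k * P                                 ≡⟨ ring₁ m q P ⟩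
  P + P * (m + P * q + q)               ≡⟨ cong (_+ P * (m + P * q + q)) (sym c+r≡P) ⟩
  c + suc (m + q) + P * (m + P * q + q) ≡⟨ ring₂ c m q P ⟩
  c + P * (m + P * q) + k               ∎)
  where
  P = 2 ^ b
  k = suc (m + q) + P * q
  ring₁ : ∀ m q P → (suc (m + q) + P * q) * P ≡ P + P * (m + P * q + q)
  ring₁ = solve-∀
  ring₂ : ∀ c m q P → c + suc (m + q) + P * (m + P * q + q) ≡ c + P * (m + P * q) + (suc (m + q) + P * q)
  ring₂ = solve-∀

*-M-digits-borrow : ∀ b p d c c′ k → k ≡ suc p + 2 ^ b * suc (p + d) → c + suc p ≡ 2 ^ b → c′ + suc d ≡ 2 ^ b →
                    k * M b ≡ c + 2 ^ b * (c′ + 2 ^ b * (p + d))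
*-M-digits-borrow b p d c c′ .(suc p + 2 ^ b * suc (p + d)) refl c+r≡P c′+d≡P = +-cancelʳ-≡ k _ _ (begin
  k * M b + k                                           ≡⟨ trans (+-comm (k * M b) k) (sym (*-suc k (M b))) ⟩
  k * suc (M b)                                         ≡⟨ cong (k *_) (suc[M]≡2^ b) ⟩
  k * P                                                 ≡⟨ ring₁ p d P ⟩
  P + P * P + P * (p + P * (p + d))
    ≡⟨ cong₂ (λ x y → x + P * y + P * (p + P * (p + d))) (sym c+r≡P) (sym c′+d≡P) ⟩
  c + suc p + P * (c′ + suc d) + P * (p + P * (p + d))  ≡⟨ ring₂ c c′ p d P ⟩
  c + P * (c′ + P * (p + d)) + k                        ∎)
  where
  P = 2 ^ b
  k = suc p + P * suc (p + d)
  ring₁ : ∀ p d P → (suc p + P * suc (p + d)) * P ≡ P + P * P + P * (p + P * (p + d))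
  ring₁ = solve-∀
  ring₂ : ∀ c c′ p d P → c + suc p + P * (c′ + suc d) + P * (p + P * (p + d)) ≡ c + P * (c′ + P * (p + d)) + (suc p + P * suc (p + d))
  ring₂ = solve-∀

s₂-*-M : ∀ b m q k → k ≡ suc (m + q) + 2 ^ b * q → suc (m + q) ≤ 2 ^ b →
         s₂ (k * M b) + s₂ (m + q) ≡ b + (s₂ m + s₂ q)
s₂-*-M b m q k k≡ r≤P = begin
  s₂ (k * M b) + s₂ (m + q)                         ≡⟨ cong (λ n → s₂ n + s₂ (m + q)) (*-M-digits b m q c k k≡ c+r≡P) ⟩
  s₂ (c + 2 ^ b * (m + 2 ^ b * q)) + s₂ (m + q)     ≡⟨ cong (_+ s₂ (m + q)) (s₂-concat b _ c (c+1+n≡P⇒c<P c+r≡P)) ⟩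
  s₂ c + s₂ (m + 2 ^ b * q) + s₂ (m + q)            ≡⟨ cong (λ n → s₂ c + n + s₂ (m + q)) (s₂-concat b q m m<P) ⟩
  s₂ c + (s₂ m + s₂ q) + s₂ (m + q)                 ≡⟨ swap (s₂ c) (s₂ m + s₂ q) (s₂ (m + q)) ⟩
  s₂ c + s₂ (m + q) + (s₂ m + s₂ q)                 ≡⟨ cong (_+ (s₂ m + s₂ q)) (s₂-complement b c (m + q) c+r≡P) ⟩
  b + (s₂ m + s₂ q)                                 ∎
  where
  c = 2 ^ b ∸ suc (m + q)
  c+r≡P : c + suc (m + q) ≡ 2 ^ b
  c+r≡P = m∸n+n≡m r≤P
  m<P : m < 2 ^ b
  m<P = <-≤-trans (s≤s (m≤m+n m q)) r≤P
  swap : ∀ x y z → x + y + z ≡ x + z + y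
  swap = solve-∀

s₂-*-M-borrow : ∀ b p d k → k ≡ suc p + 2 ^ b * suc (p + d) → suc p ≤ 2 ^ b → suc d ≤ 2 ^ b →
                s₂ (k * M b) + (s₂ p + s₂ d) ≡ b + b + s₂ (p + d)
s₂-*-M-borrow b p d k k≡ r≤P d<P = begin
  s₂ (k * M b) + (s₂ p + s₂ d)                          ≡⟨ cong (_+ (s₂ p + s₂ d)) (begin
      s₂ (k * M b)                                          ≡⟨ cong s₂ (*-M-digits-borrow b p d c c′ k k≡ c+r≡P c′+d≡P) ⟩
      s₂ (c + 2 ^ b * (c′ + 2 ^ b * (p + d)))               ≡⟨ s₂-concat b _ c (c+1+n≡P⇒c<P c+r≡P) ⟩
      s₂ c + s₂ (c′ + 2 ^ b * (p + d))                      ≡⟨ cong (s₂ c +_) (s₂-concat b (p + d) c′ (c+1+n≡P⇒c<P c′+d≡P)) ⟩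
      s₂ c + (s₂ c′ + s₂ (p + d))                           ∎) ⟩
  s₂ c + (s₂ c′ + s₂ (p + d)) + (s₂ p + s₂ d)           ≡⟨ ring (s₂ c) (s₂ c′) (s₂ (p + d)) (s₂ p) (s₂ d) ⟩
  (s₂ c + s₂ p) + (s₂ c′ + s₂ d) + s₂ (p + d)
    ≡⟨ cong₂ (λ x y → x + y + s₂ (p + d)) (s₂-complement b c p c+r≡P) (s₂-complement b c′ d c′+d≡P) ⟩
  b + b + s₂ (p + d)                                    ∎
  where
  c = 2 ^ b ∸ suc p
  c′ = 2 ^ b ∸ suc d
  c+r≡P : c + suc p ≡ 2 ^ b
  c+r≡P = m∸n+n≡m r≤P
  c′+d≡P : c′ + suc d ≡ 2 ^ b
  c′+d≡P = m∸n+n≡m d<P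
  ring : ∀ x y z v w → x + (y + z) + (v + w) ≡ (x + v) + (y + w) + z
  ring = solve-∀

R-low-digits : ∀ u K a R k → k ≡ M u + 2 ^ u * K → k ≡ R + 2 ^ suc a * M u → R < 2 ^ a →
             Σ ℕ λ W → R ≡ M u + 2 ^ u * W
R-low-digits u K a R k k≡M k≡R R<2^a with u ≤? a
... | yes u≤a = (R / 2 ^ u) {{m^n≢0 2 u}} , trans (m≡m%n+[m/n]*n R (2 ^ u) {{m^n≢0 2 u}})
                          (cong₂ _+_ (R%2^j≡Mj u K a R k k≡M k≡R ≤-refl (m≤n⇒m≤1+n u≤a)) (*-comm _ (2 ^ u)))
... | no  u≰a = contradiction R<2^a (≤⇒≯ (subst (2 ^ a ≤_) (sym R≡M[1+a]) (2^≤M[1+] a)))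
  where
  R≡M[1+a] : R ≡ M (suc a)
  R≡M[1+a] = trans (sym (m<n⇒m%n≡m {{m^n≢0 2 (suc a)}} (<-≤-trans R<2^a (^-monoʳ-≤ 2 (n≤1+n a)))))
                   (R%2^j≡Mj u K a R k k≡M k≡R (≰⇒> u≰a) ≤-refl)

[m+2z]%2≡1 : ∀ m z n → m + 2 * z ≡ suc (2 * n) → m % 2 ≡ 1
[m+2z]%2≡1 m z n e = begin
  m % 2               ≡⟨ sym ([m+kn]%n≡m%n m z 2) ⟩
  (m + z * 2) % 2     ≡⟨ cong (λ v → (m + v) % 2) (*-comm z 2) ⟩
  (m + 2 * z) % 2     ≡⟨ cong (_% 2) e ⟩
  suc (2 * n) % 2     ≡⟨ [b+2n]%2≡b 1 n (s≤s (s≤s z≤n)) ⟩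
  1                   ∎

odd-summand : ∀ x y z n → x + y + 2 * z ≡ suc (2 * n) → x % 2 ≡ 1 ⊎ y % 2 ≡ 1
odd-summand x y z n e with evenOrOdd x
... | odd x′  = inj₁ ([b+2n]%2≡b 1 x′ (s≤s (s≤s z≤n)))
... | even x′ = inj₂ ([m+2z]%2≡1 y (x′ + z) n (trans (ring x′ y z) e))
  where
  ring : ∀ x y z → y + 2 * (x + z) ≡ 2 * x + y + 2 * z
  ring = solve-∀

odd-if-+odd≡even : ∀ x g n → x + suc (g * 2) ≡ n + n → x % 2 ≡ 1
odd-if-+odd≡even x g n e with evenOrOdd x
... | odd x′  = [b+2n]%2≡b 1 x′ (s≤s (s≤s z≤n))
... | even x′ = contradiction (trans (ring₁ n) (trans (sym e) (ring₂ x′ g))) (even≢odd n (x′ + g))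
  where
  ring₁ : ∀ n → 2 * n ≡ n + n
  ring₁ = solve-∀
  ring₂ : ∀ x g → 2 * x + suc (g * 2) ≡ suc (2 * (x + g))
  ring₂ = solve-∀

t[k*Ma]≡1 : ∀ h u a k → u ≡ h * 2 → 1 ≤ u → k ≡ M u + 2 ^ suc a * M u → M u < 2 ^ a → t (k * M a) ≡ 1
t[k*Ma]≡1 zero    .0             a k refl ()
t[k*Ma]≡1 (suc g) .(suc g * 2) a k refl _ k≡ Mu<2^a =
  odd-if-+odd≡even (s₂ (k * M a)) g a (+-cancelʳ-≡ (suc v) _ _ (begin
    s₂ (k * M a) + v + suc v            ≡⟨ +-assoc (s₂ (k * M a)) v (suc v) ⟩
    s₂ (k * M a) + (v + suc v)          ≡⟨ cong₂ (λ x y → s₂ (k * M a) + (x + y)) (sym s₂p≡v) (sym (s₂-M (suc v))) ⟩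
    s₂ (k * M a) + (s₂ p + s₂ (M u))    ≡⟨ s₂-*-M-borrow a p (M u) k k≡1+p+2^a* (<⇒≤ Mu<2^a) Mu<2^a ⟩
    a + a + s₂ (p + M u)                ≡⟨ cong (λ x → a + a + s₂ x) (ring p) ⟩
    a + a + s₂ (suc (2 * p))            ≡⟨ cong (a + a +_) (trans (s₂-double+1 p) (cong suc s₂p≡v)) ⟩
    a + a + suc v                       ∎))
  where
  u = suc g * 2
  v = suc (g * 2)
  p = 2 * M v
  s₂p≡v : s₂ p ≡ v
  s₂p≡v = trans (s₂-double (M v)) (s₂-M v)
  ring : ∀ p → p + suc p ≡ suc (2 * p)
  ring = solve-∀
  k≡1+p+2^a* : k ≡ suc p + 2 ^ a * suc (p + M u)
  k≡1+p+2^a* = trans k≡ (ring′ p (2 ^ a))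
    where
    ring′ : ∀ p P → suc p + 2 * P * suc p ≡ suc p + P * suc (p + suc p)
    ring′ = solve-∀

t[k*Ma]≡1⊎t[k*M[1+a]]≡1 : ∀ h u a w R k → u ≡ h * 2 → R ≡ M u + 2 ^ u * suc w → k ≡ R + 2 ^ suc a * M u → R < 2 ^ a →
                    t (k * M a) ≡ 1 ⊎ t (k * M (suc a)) ≡ 1
t[k*Ma]≡1⊎t[k*M[1+a]]≡1 h .(h * 2) a w R k refl R≡ k≡ R<2^a =
  odd-summand (s₂ (k * M a)) (s₂ (k * M (suc a))) (s₂ p) (a + s₂ w + 3 * h) (begin
    s₂ (k * M a) + s₂ (k * M (suc a)) + 2 * s₂ p                ≡⟨ ring₁ (s₂ (k * M a)) (s₂ (k * M (suc a))) (s₂ p) ⟩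
    (s₂ (k * M a) + s₂ p) + (s₂ (k * M (suc a)) + s₂ p)         ≡⟨ cong₂ _+_ digits-a digits-1+a ⟩
    (a + (s₂ w + u)) + (suc a + ((u + s₂ w) + u))               ≡⟨ ring₂ a (s₂ w) h ⟩
    suc (2 * (a + s₂ w + 3 * h))                                ∎)
  where
  u = h * 2
  Q = M u
  A = 2 ^ u
  p = A * w + 2 * Q
  ring₁ : ∀ x y z → x + y + 2 * z ≡ (x + z) + (y + z)
  ring₁ = solve-∀
  ring₂ : ∀ a s h → (a + (s + h * 2)) + (suc a + ((h * 2 + s) + h * 2)) ≡ suc (2 * (a + s + 3 * h))
  ring₂ = solve-∀
  ring₃ : ∀ Q A w → Q + A * suc w ≡ A + (Q + A * w)
  ring₃ = solve-∀
  ring₄ : ∀ Q A w → suc Q + (Q + A * w) ≡ suc (A * w + 2 * Q)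
  ring₄ = solve-∀
  ring₅ : ∀ r P Q → r + 2 * P * Q ≡ r + P * (2 * Q)
  ring₅ = solve-∀
  ring₆ : ∀ Q A w → A * w + 2 * Q ≡ Q + A * w + Q
  ring₆ = solve-∀
  R≡1+p : R ≡ suc p
  R≡1+p = begin
    R                   ≡⟨ R≡ ⟩
    Q + A * suc w       ≡⟨ ring₃ Q A w ⟩
    A + (Q + A * w)     ≡⟨ cong (_+ (Q + A * w)) (sym (suc[M]≡2^ u)) ⟩
    suc Q + (Q + A * w) ≡⟨ ring₄ Q A w ⟩
    suc p               ∎
  R≤2^a : suc p ≤ 2 ^ a
  R≤2^a = subst (_≤ 2 ^ a) R≡1+p (<⇒≤ R<2^a)
  s₂[A*w]≡s₂w : s₂ (A * w) ≡ s₂ w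
  s₂[A*w]≡s₂w = s₂-concat u w 0 (m^n>0 2 u)
  digits-a : s₂ (k * M a) + s₂ p ≡ a + (s₂ w + u)
  digits-a = begin
    s₂ (k * M a) + s₂ p                 ≡⟨ s₂-*-M a (A * w) (2 * Q) k k≡1+p+2^a*2Q R≤2^a ⟩
    a + (s₂ (A * w) + s₂ (2 * Q))       ≡⟨ cong₂ (λ x y → a + (x + y)) s₂[A*w]≡s₂w (trans (s₂-double Q) (s₂-M u)) ⟩
    a + (s₂ w + u)                      ∎
    where
    k≡1+p+2^a*2Q : k ≡ suc p + 2 ^ a * (2 * Q)
    k≡1+p+2^a*2Q = trans k≡ (trans (cong (_+ 2 * 2 ^ a * Q) R≡1+p) (ring₅ (suc p) (2 ^ a) Q))
  digits-1+a : s₂ (k * M (suc a)) + s₂ p ≡ suc a + ((u + s₂ w) + u)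
  digits-1+a = begin
    s₂ (k * M (suc a)) + s₂ p                     ≡⟨ cong (λ x → s₂ (k * M (suc a)) + s₂ x) (ring₆ Q A w) ⟩
    s₂ (k * M (suc a)) + s₂ (Q + A * w + Q)
      ≡⟨ s₂-*-M (suc a) (Q + A * w) Q k (trans k≡ (cong (_+ 2 ^ suc a * Q) R≡1+p′)) R≤2^[1+a] ⟩
    suc a + (s₂ (Q + A * w) + s₂ Q)
      ≡⟨ cong₂ (λ x y → suc a + (x + y)) (trans (s₂-concat u w Q (M<2^ u)) (cong (_+ s₂ w) (s₂-M u))) (s₂-M u) ⟩
    suc a + ((u + s₂ w) + u)                      ∎
    where
    R≡1+p′ : R ≡ suc (Q + A * w + Q)
    R≡1+p′ = trans R≡1+p (cong suc (ring₆ Q A w))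
    R≤2^[1+a] : suc (Q + A * w + Q) ≤ 2 ^ suc a
    R≤2^[1+a] = subst (_≤ 2 ^ suc a) R≡1+p′ (≤-trans (<⇒≤ R<2^a) (^-monoʳ-≤ 2 (n≤1+n a)))

M[1+a]<k : ∀ u a R k → 1 ≤ u → k ≡ R + 2 ^ suc a * M u → M (suc a) < k
M[1+a]<k (suc u) a R k _ k≡ =
  <-≤-trans (M<2^ (suc a)) (≤-trans (m≤m*n (2 ^ suc a) (M (suc u))) (subst (_ ≤_) (sym k≡) (m≤n+m _ R)))

M[a]<k : ∀ u a R k → 1 ≤ u → k ≡ R + 2 ^ suc a * M u → M a < k
M[a]<k u a R k 1≤u k≡ = ≤-<-trans (M≤M[1+] a) (M[1+a]<k u a R k 1≤u k≡)

t[kn]≡1-for-some-n<k : ∀ h u K a R k → u ≡ h * 2 → 1 ≤ u → k ≡ M u + 2 ^ u * K → k ≡ R + 2 ^ suc a * M u → R < 2 ^ a →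
                       Σ ℕ λ n → n < k × t (k * n) ≡ 1
t[kn]≡1-for-some-n<k h u K a R k u≡ 1≤u k≡M k≡R R<2^a with R-low-digits u K a R k k≡M k≡R R<2^a
... | zero , R≡ = M a , M[a]<k u a R k 1≤u k≡R ,
  t[k*Ma]≡1 h u a k u≡ 1≤u (trans k≡R (cong (_+ 2 ^ suc a * M u) R≡Mu)) (subst (_< 2 ^ a) R≡Mu R<2^a)
  where
  R≡Mu : R ≡ M u
  R≡Mu = trans R≡ (trans (cong (M u +_) (*-zeroʳ (2 ^ u))) (+-identityʳ (M u)))
... | suc w , R≡ with t[k*Ma]≡1⊎t[k*M[1+a]]≡1 h u a w R k u≡ R≡ k≡R R<2^a
...   | inj₁ t≡1 = M a , M[a]<k u a R k 1≤u k≡R , t≡1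
...   | inj₂ t≡1 = M (suc a) , M[1+a]<k u a R k 1≤u k≡R , t≡1

least-or-none : ∀ {P : ℕ → Set} → Decidable P → ∀ n →
                (Σ ℕ λ m → m ≤ n × P m × (∀ i → i < m → ¬ P i)) ⊎ (∀ i → i ≤ n → ¬ P i)
least-or-none P? zero with P? 0
... | yes P0 = inj₁ (0 , z≤n , P0 , λ _ ())
... | no ¬P0 = inj₂ λ { zero _ → ¬P0 }
least-or-none P? (suc n) with least-or-none P? n
... | inj₁ (m , m≤n , Pm , least) = inj₁ (m , m≤n⇒m≤1+n m≤n , Pm , least)
... | inj₂ none with P? (suc n)
...   | yes P[1+n] = inj₁ (suc n , ≤-refl , P[1+n] , λ i i<1+n → none i (s≤s⁻¹ i<1+n))
...   | no ¬P[1+n] = inj₂ λ i i≤1+n →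
  [ (λ i<1+n → none i (s≤s⁻¹ i<1+n)) , (λ { refl → ¬P[1+n] }) ]′ (m≤n⇒m<n∨m≡n i≤1+n)

least-witness : ∀ {P : ℕ → Set} → Decidable P → ∀ n → P n → Σ ℕ λ m → m ≤ n × P m × (∀ i → i < m → ¬ P i)
least-witness P? n Pn with least-or-none P? n
... | inj₁ least = least
... | inj₂ none  = contradiction Pn (none n ≤-refl)

t≢1⇒t≡0 : ∀ n → t n ≢ 1 → t n ≡ 0
t≢1⇒t≡0 n t≢1 with t n | m%n<n (s₂ n) 2
... | zero        | _             = refl
... | suc zero    | _             = contradiction refl t≢1
... | suc (suc _) | s≤s (s≤s ())

IsF-≤-witness : ∀ k n → t (k * n) ≡ 1 → Σ ℕ λ m → IsF k m × m ≤ n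
IsF-≤-witness k n t≡1 with least-witness (λ i → t (k * i) ≟ 1) n t≡1
... | m , m≤n , t[km]≡1 , least = m , (t[km]≡1 , λ i i<m → t≢1⇒t≡0 (k * i) (least i i<m)) , m≤n

lemma4 : (k : ℕ) → 1 ≤ k →
    (u s : ℕ) → 2 ∣ u → 2 ≤ u → 1 ≤ s → s < u ∸ 1 →
    u + 2 ≤ ℓ k → L (u + 2) k ≡ false ∷ false ∷ replicate u true →
    u + s + 1 ≤ ℓ k → U (u + s + 1) k ≡ replicate u true ++ replicate s false ++ true ∷ [] →
    Σ ℕ (λ m → IsF k m × m < k)
lemma4 k _ u s (divides h u≡h*2) 2≤u 1≤s _ _ L≡ _ U≡ =
  let K , k≡Mu+2^u*K                  = L-ones-form (u + 2) k u (false ∷ false ∷ []) L≡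
      a , R , R<2^a , k≡R+2^[1+a]*Mu  = U-form (u + s + 1) k u s 1≤s U≡
      n , n<k , t[kn]≡1               = t[kn]≡1-for-some-n<k h u K a R k u≡h*2 (≤-trans (s≤s z≤n) 2≤u)
                                          k≡Mu+2^u*K k≡R+2^[1+a]*Mu R<2^a
      m , IsF[k,m] , m≤n              = IsF-≤-witness k n t[kn]≡1
  in m , IsF[k,m] , ≤-<-trans m≤n n<k
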